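{- Every nonempty finite set of integers is the signed degree set of some connected signed bipartite graph.
   Context: A bipartite graph $G(U,V)$ is a finite simple graph whose vertex set is partitioned into two nonempty disjoint sets $U$ and $V$ such that every edge joins a vertex of $U$ to a vertex of $V$. A signed bipartite graph is a bipartite graph in which each edge is assigned a sign, positive or negative. The signed degree of a vertex $x$ is the number of positive edges incident with $x$ minus the number of negative edges incident with $x$. The signed degree set of a signed bipartite graph is the set of distinct signed degrees of its vertices. The signed bipartite graph is connected if its underlying graph is connected (every vertex of $U$ is joined by a path to every vertex of $V$). -}

module Defs where

open import Data.Nat using (ℕ; suc)
open import Data.Integer using (ℤ; +_; _+_; -_; 0ℤ; 1ℤ)
open import Data.Fin using (Fin)
open import Data.Maybe using (Maybe; just; nothing)
open import Data.Sum using (_⊎_; inj₁; inj₂)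
open import Data.Product using (∃; _×_; Σ)
open import Data.List using (List)
open import Data.List.Membership.Propositional using (_∈_)
open import Relation.Binary.PropositionalEquality using (_≡_)
open import Function.Bundles using (_⇔_)

data Sign : Set where
  pos neg : Sign

signValue : Sign → ℤ
signValue pos = 1ℤ
signValue neg = - 1ℤ

-- A signed bipartite graph with parts U = Fin (suc p) and V = Fin (suc q)
-- (both nonempty).  For u ∈ U, v ∈ V, 'edge u v' is 'nothing' if u and v are
-- not adjacent and 'just s' if they are joined by an edge of sign s.
-- (Simple: at most one edge between any pair; bipartite: edges only U–V.)
record SignedBipartite (p q : ℕ) : Set where
  field
    edge : Fin (suc p) → Fin (suc q) → Maybe Sign

open SignedBipartite public

contrib : Maybe Sign → ℤ
contrib nothing  = 0ℤ
contrib (just s) = signValue s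

sumFin : ∀ {k} → (Fin k → ℤ) → ℤ
sumFin {ℕ.zero} f = 0ℤ
sumFin {suc k} f = f Fin.zero + sumFin {k} (λ i → f (Fin.suc i))

Vertex : ℕ → ℕ → Set
Vertex p q = Fin (suc p) ⊎ Fin (suc q)

signedDegree : ∀ {p q} → SignedBipartite p q → Vertex p q → ℤ
signedDegree G (inj₁ u) = sumFin (λ v → contrib (edge G u v))
signedDegree G (inj₂ v) = sumFin (λ u → contrib (edge G u v))

Adjacent : ∀ {p q} → SignedBipartite p q → Vertex p q → Vertex p q → Set
Adjacent G (inj₁ u) (inj₁ u') = Data.Empty.⊥ where import Data.Empty
Adjacent G (inj₁ u) (inj₂ v)  = ∃ λ s → edge G u v ≡ just s
Adjacent G (inj₂ v) (inj₁ u)  = ∃ λ s → edge G u v ≡ just s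
Adjacent G (inj₂ v) (inj₂ v') = Data.Empty.⊥ where import Data.Empty

data Path {p q} (G : SignedBipartite p q) : Vertex p q → Vertex p q → Set where
  here : ∀ {x} → Path G x x
  step : ∀ {x y z} → Adjacent G x y → Path G y z → Path G x z

Connected : ∀ {p q} → SignedBipartite p q → Set
Connected G = ∀ x y → Path G x y

HasSignedDegreeSet : ∀ {p q} → SignedBipartite p q → List ℤ → Set
HasSignedDegreeSet G S = ∀ (d : ℤ) → (d ∈ S) ⇔ (∃ λ x → signedDegree G x ≡ d)

{-# OPTIONS --safe #-}
-- A value d is realised by a complete bipartite graph K(n,n), n = ∣d∣ + 2, whose edges all carry
-- the sign σ of d except for a perfect matching of sign −σ: every vertex then has signed degree
-- (n − 1)σ − σ = ∣d∣σ = d.  The blocks of the successive values are chained by alternating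
-- 4-cycles, each joining two U-vertices of one block to two V-vertices of the next; such a cycle
-- adds 0 to every signed degree but makes the whole graph connected.
module Submission where

open import Defs
open import Data.Nat as ℕ using (ℕ; zero; suc)
open import Data.Integer using (ℤ; +_; -[1+_]; _+_; _*_; -_; 0ℤ; 1ℤ; ∣_∣)
import Data.Integer.Properties as ℤ
open import Data.Fin using (Fin; zero; suc; _↑ˡ_; _↑ʳ_; splitAt)
open import Data.Fin.Properties using (splitAt⁻¹-↑ˡ; splitAt⁻¹-↑ʳ)
open import Data.Vec.Functional using (Vector; _++_; transpose)
open import Data.Vec.Functional.Properties using (lookup-++ˡ; lookup-++ʳ)
open import Data.Maybe using (Maybe; just; nothing)
open import Data.Sum as Sum using (inj₁; inj₂)
open import Data.Product using (∃; ∃₂; Σ; _×_; _,_; map₂)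
open import Data.List using (List; []; _∷_)
open import Data.List.Membership.Propositional using (_∈_)
open import Data.List.Relation.Unary.Any using (here; there)
open import Function using (_∘_; const)
open import Function.Bundles using (Equivalence; mk⇔)
open import Relation.Nullary using (contradiction)
open import Algebra.Properties.CommutativeSemigroup ℤ.+-commutativeSemigroup using (x∙yz≈y∙xz)
open import Relation.Binary.PropositionalEquality
  using (_≡_; _≢_; _≗_; refl; sym; trans; cong; cong₂; cong-app; subst; module ≡-Reasoning)

private
  variable
    k k₁ k₂ l l₁ l₂ m m₁ m₂ n n₁ n₂ p q : ℕ
    d : ℤ
    S : List ℤ

sumFin-cong : {f g : Fin n → ℤ} → f ≗ g → sumFin f ≡ sumFin g
sumFin-cong {zero}  eq = refl
sumFin-cong {suc n} eq = cong₂ _+_ (eq zero) (sumFin-cong (eq ∘ suc))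

sumFin-const : ∀ n (z : ℤ) → sumFin {n} (const z) ≡ + n * z
sumFin-const zero    z = refl
sumFin-const (suc n) z = trans (cong (_+_ z) (sumFin-const n z)) (sym (ℤ.suc-* (+ n) z))

sumFin-split : ∀ m (f : Fin (m ℕ.+ n) → ℤ) →
               sumFin f ≡ sumFin (f ∘ (_↑ˡ n)) + sumFin (f ∘ (m ↑ʳ_))
sumFin-split zero    f = sym (ℤ.+-identityˡ _)
sumFin-split (suc m) f = trans (cong (_+_ (f zero)) (sumFin-split m (f ∘ suc)))
                               (sym (ℤ.+-assoc (f zero) _ _))

data Split (m n : ℕ) : Fin (m ℕ.+ n) → Set where
  left  : ∀ i → Split m n (i ↑ˡ n)
  right : ∀ j → Split m n (m ↑ʳ j)

split : ∀ m n (i : Fin (m ℕ.+ n)) → Split m n i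
split m n i with splitAt m i in eq
... | inj₁ a = subst (Split m n) (splitAt⁻¹-↑ˡ eq) (left a)
... | inj₂ b = subst (Split m n) (splitAt⁻¹-↑ʳ eq) (right b)

-- Rows are indexed by U and columns by V, so that  signedDegree G (inj₁ u)  and
-- signedDegree G (inj₂ v)  are definitionally  rowSum (edge G) u  and  colSum (edge G) v.
Matrix : ℕ → ℕ → Set
Matrix m n = Vector (Vector (Maybe Sign) n) m

lineSum : Vector (Maybe Sign) n → ℤ
lineSum r = sumFin (contrib ∘ r)

rowSum : Matrix m n → Fin m → ℤ
rowSum M i = lineSum (M i)

colSum : Matrix m n → Fin n → ℤ
colSum M = rowSum (transpose M)

lineSum-cong : {r s : Vector (Maybe Sign) n} → r ≗ s → lineSum r ≡ lineSum s
lineSum-cong eq = sumFin-cong (cong contrib ∘ eq)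

lineSum-++ : (r : Vector (Maybe Sign) m) (s : Vector (Maybe Sign) n) →
             lineSum (r ++ s) ≡ lineSum r + lineSum s
lineSum-++ {m} r s = trans (sumFin-split m (contrib ∘ (r ++ s)))
  (cong₂ _+_ (lineSum-cong (lookup-++ˡ r s)) (lineSum-cong (lookup-++ʳ r s)))

transpose-++ : (R₁ : Matrix m₁ n) (R₂ : Matrix m₂ n) →
               ∀ j → transpose (R₁ ++ R₂) j ≗ transpose R₁ j ++ transpose R₂ j
transpose-++ {m₁} R₁ R₂ j i with splitAt m₁ i
... | inj₁ _ = refl
... | inj₂ _ = refl

colSum-++ : (R₁ : Matrix m₁ n) (R₂ : Matrix m₂ n) →
            ∀ j → colSum (R₁ ++ R₂) j ≡ colSum R₁ j + colSum R₂ j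
colSum-++ R₁ R₂ j =
  trans (lineSum-cong (transpose-++ R₁ R₂ j)) (lineSum-++ (transpose R₁ j) (transpose R₂ j))

record Regular (d : ℤ) (M : Matrix m n) : Set where
  field
    rows : ∀ i → rowSum M i ≡ d
    cols : ∀ j → colSum M j ≡ d

open Regular

Balanced : Matrix m n → Set
Balanced = Regular 0ℤ

Complete : Matrix m n → Set
Complete M = ∀ i j → ∃ λ s → M i j ≡ just s

empty : Matrix m n
empty _ _ = nothing

empty-balanced : Balanced (empty {m} {n})
empty-balanced {m} {n} = record
  { rows = λ _ → trans (sumFin-const n 0ℤ) (ℤ.*-zeroʳ (+ n))
  ; cols = λ _ → trans (sumFin-const m 0ℤ) (ℤ.*-zeroʳ (+ m))
  }

_∥_ : Matrix m n₁ → Matrix m n₂ → Matrix m (n₁ ℕ.+ n₂)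
(A ∥ B) i = A i ++ B i

blocks : Matrix m₁ n₁ → Matrix m₁ n₂ → Matrix m₂ n₁ → Matrix m₂ n₂ →
         Matrix (m₁ ℕ.+ m₂) (n₁ ℕ.+ n₂)
blocks A B C D = (A ∥ B) ++ (C ∥ D)

module Blocks {A : Matrix m₁ n₁} {B : Matrix m₁ n₂} {C : Matrix m₂ n₁} {D : Matrix m₂ n₂} where

  blocks-↑ˡ-↑ˡ : ∀ i j → blocks A B C D (i ↑ˡ m₂) (j ↑ˡ n₂) ≡ A i j
  blocks-↑ˡ-↑ˡ i j = trans (cong-app (lookup-++ˡ (A ∥ B) (C ∥ D) i) _) (lookup-++ˡ (A i) (B i) j)

  blocks-↑ˡ-↑ʳ : ∀ i j → blocks A B C D (i ↑ˡ m₂) (n₁ ↑ʳ j) ≡ B i j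
  blocks-↑ˡ-↑ʳ i j = trans (cong-app (lookup-++ˡ (A ∥ B) (C ∥ D) i) _) (lookup-++ʳ (A i) (B i) j)

  blocks-↑ʳ-↑ʳ : ∀ i j → blocks A B C D (m₁ ↑ʳ i) (n₁ ↑ʳ j) ≡ D i j
  blocks-↑ʳ-↑ʳ i j = trans (cong-app (lookup-++ʳ (A ∥ B) (C ∥ D) i) _) (lookup-++ʳ (C i) (D i) j)

  rowSum-blocks-↑ˡ : ∀ i → rowSum (blocks A B C D) (i ↑ˡ m₂) ≡ rowSum A i + rowSum B i
  rowSum-blocks-↑ˡ i = trans (cong lineSum (lookup-++ˡ (A ∥ B) (C ∥ D) i)) (lineSum-++ (A i) (B i))

  rowSum-blocks-↑ʳ : ∀ i → rowSum (blocks A B C D) (m₁ ↑ʳ i) ≡ rowSum C i + rowSum D i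
  rowSum-blocks-↑ʳ i = trans (cong lineSum (lookup-++ʳ (A ∥ B) (C ∥ D) i)) (lineSum-++ (C i) (D i))

  colSum-blocks-↑ˡ : ∀ j → colSum (blocks A B C D) (j ↑ˡ n₂) ≡ colSum A j + colSum C j
  colSum-blocks-↑ˡ j = trans (colSum-++ (A ∥ B) (C ∥ D) (j ↑ˡ n₂))
    (cong₂ _+_ (lineSum-cong (λ i → lookup-++ˡ (A i) (B i) j))
               (lineSum-cong (λ i → lookup-++ˡ (C i) (D i) j)))

  colSum-blocks-↑ʳ : ∀ j → colSum (blocks A B C D) (n₁ ↑ʳ j) ≡ colSum B j + colSum D j
  colSum-blocks-↑ʳ j = trans (colSum-++ (A ∥ B) (C ∥ D) (n₁ ↑ʳ j))
    (cong₂ _+_ (lineSum-cong (λ i → lookup-++ʳ (A i) (B i) j))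
               (lineSum-cong (λ i → lookup-++ʳ (C i) (D i) j)))

module BalancedBlocks {A : Matrix m₁ n₁} {B : Matrix m₁ n₂} {C : Matrix m₂ n₁} {D : Matrix m₂ n₂}
         (B-balanced : Balanced B) (C-balanced : Balanced C) where

  open Blocks {A = A} {B} {C} {D}

  rowSum-balanced-↑ˡ : ∀ i → rowSum (blocks A B C D) (i ↑ˡ m₂) ≡ rowSum A i
  rowSum-balanced-↑ˡ i =
    trans (rowSum-blocks-↑ˡ i) (trans (cong (_+_ (rowSum A i)) (rows B-balanced i)) (ℤ.+-identityʳ _))

  rowSum-balanced-↑ʳ : ∀ i → rowSum (blocks A B C D) (m₁ ↑ʳ i) ≡ rowSum D i
  rowSum-balanced-↑ʳ i =
    trans (rowSum-blocks-↑ʳ i) (trans (cong (_+ rowSum D i) (rows C-balanced i)) (ℤ.+-identityˡ _))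

  colSum-balanced-↑ˡ : ∀ j → colSum (blocks A B C D) (j ↑ˡ n₂) ≡ colSum A j
  colSum-balanced-↑ˡ j =
    trans (colSum-blocks-↑ˡ j) (trans (cong (_+_ (colSum A j)) (cols C-balanced j)) (ℤ.+-identityʳ _))

  colSum-balanced-↑ʳ : ∀ j → colSum (blocks A B C D) (n₁ ↑ʳ j) ≡ colSum D j
  colSum-balanced-↑ʳ j =
    trans (colSum-blocks-↑ʳ j) (trans (cong (_+ colSum D j) (cols B-balanced j)) (ℤ.+-identityˡ _))

  blocks-regular : Regular d A → Regular d D → Regular d (blocks A B C D)
  blocks-regular A-regular D-regular = record { rows = rows′ ; cols = cols′ }
    where
    rows′ : ∀ i → rowSum (blocks A B C D) i ≡ _
    rows′ i with split m₁ m₂ i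
    ... | left  a = trans (rowSum-balanced-↑ˡ a) (rows A-regular a)
    ... | right u = trans (rowSum-balanced-↑ʳ u) (rows D-regular u)
    cols′ : ∀ j → colSum (blocks A B C D) j ≡ _
    cols′ j with split n₁ n₂ j
    ... | left  b = trans (colSum-balanced-↑ˡ b) (cols A-regular b)
    ... | right v = trans (colSum-balanced-↑ʳ v) (cols D-regular v)

open BalancedBlocks using (blocks-regular)

alternatingSquare : Matrix 2 2
alternatingSquare zero    zero    = just pos
alternatingSquare zero    (suc _) = just neg
alternatingSquare (suc _) zero    = just neg
alternatingSquare (suc _) (suc _) = just pos

alternatingSquare-balanced : Balanced alternatingSquare
alternatingSquare-balanced = record
  { rows = λ { zero → refl ; (suc _) → refl }
  ; cols = λ { zero → refl ; (suc _) → refl }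
  }

connector : Matrix (2 ℕ.+ k) (2 ℕ.+ l)
connector = blocks alternatingSquare empty empty empty

connector-balanced : Balanced (connector {k} {l})
connector-balanced = blocks-regular empty-balanced empty-balanced alternatingSquare-balanced empty-balanced

opposite : Sign → Sign
opposite pos = neg
opposite neg = pos

signValue-opposite : ∀ σ → signValue (opposite σ) ≡ - signValue σ
signValue-opposite pos = refl
signValue-opposite neg = refl

diagonalBlock : Sign → Matrix n n
diagonalBlock σ zero    zero    = just (opposite σ)
diagonalBlock σ zero    (suc _) = just σ
diagonalBlock σ (suc _) zero    = just σ
diagonalBlock σ (suc i) (suc j) = diagonalBlock σ i j

diagonalBlock-symmetric : ∀ σ (i j : Fin n) → diagonalBlock σ i j ≡ diagonalBlock σ j i
diagonalBlock-symmetric σ zero    zero    = refl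
diagonalBlock-symmetric σ zero    (suc _) = refl
diagonalBlock-symmetric σ (suc _) zero    = refl
diagonalBlock-symmetric σ (suc i) (suc j) = diagonalBlock-symmetric σ i j

diagonalBlock-complete : ∀ σ → Complete (diagonalBlock {n} σ)
diagonalBlock-complete σ zero    zero    = opposite σ , refl
diagonalBlock-complete σ zero    (suc _) = σ , refl
diagonalBlock-complete σ (suc _) zero    = σ , refl
diagonalBlock-complete σ (suc i) (suc j) = diagonalBlock-complete σ i j

diagonalBlock-rowSum : ∀ n σ (i : Fin (suc n)) →
                       rowSum (diagonalBlock σ) i ≡ - signValue σ + + n * signValue σ
diagonalBlock-rowSum n σ zero =
  cong₂ _+_ (signValue-opposite σ) (sumFin-const n (signValue σ))
diagonalBlock-rowSum (suc n) σ (suc i) = begin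
  s + rowSum (diagonalBlock σ) i ≡⟨ cong (_+_ s) (diagonalBlock-rowSum n σ i) ⟩
  s + (- s + + n * s)            ≡⟨ x∙yz≈y∙xz s (- s) (+ n * s) ⟩
  - s + (s + + n * s)            ≡⟨ cong (_+_ (- s)) (sym (ℤ.suc-* (+ n) s)) ⟩
  - s + + suc n * s              ∎
  where
  open ≡-Reasoning
  s : ℤ
  s = signValue σ

diagonalBlock-regular : ∀ n σ → Regular (- signValue σ + + n * signValue σ) (diagonalBlock {suc n} σ)
diagonalBlock-regular n σ = record
  { rows = diagonalBlock-rowSum n σ
  ; cols = λ j → trans (lineSum-cong (λ i → diagonalBlock-symmetric σ i j)) (diagonalBlock-rowSum n σ j)
  }

signOf : ℤ → Sign
signOf (+ _)    = pos
signOf -[1+ _ ] = neg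

magnitude-signOf : ∀ d → + ∣ d ∣ * signValue (signOf d) ≡ d
magnitude-signOf (+ n)    = ℤ.*-identityʳ (+ n)
magnitude-signOf -[1+ n ] = trans (ℤ.*-comm (+ suc n) (- 1ℤ)) (ℤ.-1*i≡-i (+ suc n))

block : (d : ℤ) → Matrix (2 ℕ.+ ∣ d ∣) (2 ℕ.+ ∣ d ∣)
block d = diagonalBlock (signOf d)

block-regular : ∀ d → Regular d (block d)
block-regular d = subst (λ z → Regular z (block d)) lineSum≡d (diagonalBlock-regular (suc ∣ d ∣) (signOf d))
  where
  s : ℤ
  s = signValue (signOf d)
  lineSum≡d : - s + + suc ∣ d ∣ * s ≡ d
  lineSum≡d = begin
    - s + + suc ∣ d ∣ * s    ≡⟨ cong (_+_ (- s)) (ℤ.suc-* (+ ∣ d ∣) s) ⟩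
    - s + (s + + ∣ d ∣ * s)  ≡⟨ sym (ℤ.+-assoc (- s) s _) ⟩
    (- s + s) + + ∣ d ∣ * s  ≡⟨ cong (_+ + ∣ d ∣ * s) (ℤ.+-inverseˡ s) ⟩
    0ℤ + + ∣ d ∣ * s         ≡⟨ ℤ.+-identityˡ _ ⟩
    + ∣ d ∣ * s              ≡⟨ magnitude-signOf d ⟩
    d                        ∎
    where open ≡-Reasoning

module _ {G : SignedBipartite p q} where

  adjacent-sym : ∀ {x y} → Adjacent G x y → Adjacent G y x
  adjacent-sym {inj₁ _} {inj₂ _} a = a
  adjacent-sym {inj₂ _} {inj₁ _} a = a

  infixr 5 _▻▻_

  _▻▻_ : ∀ {x y z} → Path G x y → Path G y z → Path G x z
  here     ▻▻ r = r
  step a p ▻▻ r = step a (p ▻▻ r)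

  reverse : ∀ {x y} → Path G x y → Path G y x
  reverse here       = here
  reverse (step a p) = reverse p ▻▻ step (adjacent-sym a) here

  hub-connected : (h : Vertex p q) → (∀ x → Path G x h) → Connected G
  hub-connected h toHub x y = toHub x ▻▻ reverse (toHub y)

  complete⇒connected : Complete (edge G) → Connected G
  complete⇒connected complete = hub-connected (inj₁ zero) toHub
    where
    columnToHub : ∀ v → Path G (inj₂ v) (inj₁ zero)
    columnToHub v = step (complete zero v) here
    toHub : ∀ x → Path G x (inj₁ zero)
    toHub (inj₁ u) = step (complete u zero) (columnToHub zero)
    toHub (inj₂ v) = columnToHub v

map-path : {G : SignedBipartite p q} {G′ : SignedBipartite m n} (f : Vertex p q → Vertex m n) →
           (∀ x y → Adjacent G x y → Adjacent G′ (f x) (f y)) →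
           ∀ {x y} → Path G x y → Path G′ (f x) (f y)
map-path f f-adjacent here               = here
map-path f f-adjacent (step {x} {y} a p) = step (f-adjacent x y a) (map-path f f-adjacent p)

regular⇒hasSignedDegreeSet : (G : SignedBipartite p q) → Regular d (edge G) → HasSignedDegreeSet G (d ∷ [])
regular⇒hasSignedDegreeSet G regular e = mk⇔ realised listed
  where
  degree : ∀ x → signedDegree G x ≡ _
  degree (inj₁ u) = rows regular u
  degree (inj₂ v) = cols regular v
  realised : e ∈ _ ∷ [] → ∃ λ x → signedDegree G x ≡ e
  realised (here refl) = inj₁ zero , degree (inj₁ zero)
  listed : (∃ λ x → signedDegree G x ≡ e) → e ∈ _ ∷ []
  listed (x , refl) = here (degree x)

attach : Matrix (suc k₁) (suc l₁) → Matrix (suc k₁) (suc l₂) → SignedBipartite k₂ l₂ →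
         SignedBipartite (k₁ ℕ.+ suc k₂) (l₁ ℕ.+ suc l₂)
attach B C G = record { edge = blocks B C empty (edge G) }

module Attach {B : Matrix (suc k₁) (suc l₁)} {C : Matrix (suc k₁) (suc l₂)} {G : SignedBipartite k₂ l₂} where

  G′ : SignedBipartite (k₁ ℕ.+ suc k₂) (l₁ ℕ.+ suc l₂)
  G′ = attach B C G

  open Blocks {A = B} {B = C} {C = empty} {D = edge G}

  inBlock : Vertex k₁ l₁ → Vertex (k₁ ℕ.+ suc k₂) (l₁ ℕ.+ suc l₂)
  inBlock = Sum.map (_↑ˡ suc k₂) (_↑ˡ suc l₂)

  embed : Vertex k₂ l₂ → Vertex (k₁ ℕ.+ suc k₂) (l₁ ℕ.+ suc l₂)
  embed = Sum.map (suc k₁ ↑ʳ_) (suc l₁ ↑ʳ_)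

  data AttachedVertex : Vertex (k₁ ℕ.+ suc k₂) (l₁ ℕ.+ suc l₂) → Set where
    block-vertex    : ∀ x → AttachedVertex (inBlock x)
    embedded-vertex : ∀ x → AttachedVertex (embed x)

  attachedVertex : ∀ x → AttachedVertex x
  attachedVertex (inj₁ u) with split (suc k₁) (suc k₂) u
  ... | left  a = block-vertex (inj₁ a)
  ... | right b = embedded-vertex (inj₁ b)
  attachedVertex (inj₂ v) with split (suc l₁) (suc l₂) v
  ... | left  a = block-vertex (inj₂ a)
  ... | right b = embedded-vertex (inj₂ b)

  embed-adjacent : ∀ x y → Adjacent G x y → Adjacent G′ (embed x) (embed y)
  embed-adjacent (inj₁ u) (inj₂ v) = map₂ (trans (blocks-↑ʳ-↑ʳ u v))
  embed-adjacent (inj₂ v) (inj₁ u) = map₂ (trans (blocks-↑ʳ-↑ʳ u v))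

  connected : Complete B → ∀ {i j s} → C i j ≡ just s → Connected G → Connected G′
  connected B-complete {i} {j} {s} Cij≡s G-connected = hub-connected hub toHub
    where
    hub : Vertex (k₁ ℕ.+ suc k₂) (l₁ ℕ.+ suc l₂)
    hub = inj₁ (i ↑ˡ suc k₂)
    inBlock-adjacent : ∀ a b → Adjacent G′ (inj₁ (a ↑ˡ suc k₂)) (inj₂ (b ↑ˡ suc l₂))
    inBlock-adjacent a b = map₂ (trans (blocks-↑ˡ-↑ˡ a b)) (B-complete a b)
    columnToHub : ∀ b → Path G′ (inj₂ (b ↑ˡ suc l₂)) hub
    columnToHub b = step (inBlock-adjacent i b) here
    toHub : ∀ x → Path G′ x hub
    toHub x with attachedVertex x
    ... | block-vertex (inj₁ a) = step (inBlock-adjacent a zero) (columnToHub zero)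
    ... | block-vertex (inj₂ b) = columnToHub b
    ... | embedded-vertex y     = map-path embed embed-adjacent (G-connected y (inj₂ j))
                                  ▻▻ step (s , trans (blocks-↑ˡ-↑ʳ i j) Cij≡s) here

  module _ (B-regular : Regular d B) (C-balanced : Balanced C) where

    open BalancedBlocks {A = B} {B = C} {C = empty} {D = edge G} C-balanced empty-balanced

    signedDegree-inBlock : ∀ x → signedDegree G′ (inBlock x) ≡ d
    signedDegree-inBlock (inj₁ a) = trans (rowSum-balanced-↑ˡ a) (rows B-regular a)
    signedDegree-inBlock (inj₂ b) = trans (colSum-balanced-↑ˡ b) (cols B-regular b)

    signedDegree-embed : ∀ x → signedDegree G′ (embed x) ≡ signedDegree G x
    signedDegree-embed (inj₁ u) = rowSum-balanced-↑ʳ u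
    signedDegree-embed (inj₂ v) = colSum-balanced-↑ʳ v

    hasSignedDegreeSet : HasSignedDegreeSet G S → HasSignedDegreeSet G′ (d ∷ S)
    hasSignedDegreeSet {S} G-S e = mk⇔ realised listed
      where
      realised : e ∈ d ∷ S → ∃ λ x → signedDegree G′ x ≡ e
      realised (here refl) = inBlock (inj₁ zero) , signedDegree-inBlock (inj₁ zero)
      realised (there e∈S) with Equivalence.to (G-S e) e∈S
      ... | x , degree≡e = embed x , trans (signedDegree-embed x) degree≡e
      listed : (∃ λ x → signedDegree G′ x ≡ e) → e ∈ d ∷ S
      listed (x , refl) with attachedVertex x
      ... | block-vertex y    = here (signedDegree-inBlock y)
      ... | embedded-vertex y =
        there (subst (_∈ S) (sym (signedDegree-embed y)) (Equivalence.from (G-S _) (y , refl)))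

-- Each side of  realisation d S  has  Σ_{x ∈ d ∷ S} (∣ x ∣ + 2) = 2 + size d S  vertices.
size : ℤ → List ℤ → ℕ
size d []      = ∣ d ∣
size d (e ∷ S) = ∣ d ∣ ℕ.+ suc (suc (size e S))

realisation : ∀ d S → SignedBipartite (suc (size d S)) (suc (size d S))
realisation d []      = record { edge = block d }
realisation d (e ∷ S) = attach (block d) connector (realisation e S)

realisation-connected : ∀ d S → Connected (realisation d S)
realisation-connected d []      = complete⇒connected (diagonalBlock-complete (signOf d))
realisation-connected d (e ∷ S) =
  Attach.connected (diagonalBlock-complete (signOf d)) {zero} {zero} refl (realisation-connected e S)

realisation-hasSignedDegreeSet : ∀ d S → HasSignedDegreeSet (realisation d S) (d ∷ S)
realisation-hasSignedDegreeSet d []      = regular⇒hasSignedDegreeSet (realisation d []) (block-regular d)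
realisation-hasSignedDegreeSet d (e ∷ S) =
  Attach.hasSignedDegreeSet (block-regular d) connector-balanced (realisation-hasSignedDegreeSet e S)

theorem2p2 : (S : List ℤ) → S ≢ [] →
    ∃₂ λ (p q : ℕ) → Σ (SignedBipartite p q) λ G →
      Connected G × HasSignedDegreeSet G S
theorem2p2 []      S≢[] = contradiction refl S≢[]
theorem2p2 (d ∷ S) _    =
  suc (size d S) , suc (size d S) , realisation d S ,
  realisation-connected d S , realisation-hasSignedDegreeSet d S
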